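{- Let $G=(V,E)$ be a simple graph and let $\vec{\lambda}:V\to\mathbb{Z}_{\geq 0}$ be a labelling of the vertices of $G$. If the bounded degree complex $\mathrm{BD}^{\vec{\lambda}}(G)$ contains two connected components each with more than one vertex, then $G$ contains a cycle of length $4$.
   Context: The bounded degree complex $\mathrm{BD}^{\vec{\lambda}}(G)$ is the simplicial complex whose vertices are the edges of $G$ and whose faces are the subsets $H\subseteq E$ such that every vertex $v\in V$ has degree at most $\vec{\lambda}(v)$ in the subgraph with edge set $H$. -}

module Defs where

open import Data.Nat using (ℕ; suc; _≤_)
open import Data.Fin using (Fin; _<_; _≟_)
open import Data.List using (List; []; _∷_)
open import Data.Product using (_×_; Σ; ∃-syntax; _,_)
open import Data.Sum using (_⊎_)
open import Relation.Nullary using (¬_; yes; no)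
open import Relation.Binary.PropositionalEquality using (_≡_; _≢_)
open import Relation.Binary.Construct.Closure.ReflexiveTransitive using (Star)

record SimpleGraph (n : ℕ) : Set₁ where
  field
    Adj    : Fin n → Fin n → Set
    sym    : ∀ {u v} → Adj u v → Adj v u
    irrefl : ∀ {u} → ¬ Adj u u
open SimpleGraph public

-- An edge {u,v} of G, represented canonically with u < v.
record Edge {n : ℕ} (G : SimpleGraph n) : Set where
  constructor edge
  field
    src : Fin n
    tgt : Fin n
    src<tgt : src < tgt
    adj : Adj G src tgt
open Edge public

_≈E_ : ∀ {n} {G : SimpleGraph n} → Edge G → Edge G → Set
e ≈E f = (src e ≡ src f) × (tgt e ≡ tgt f)

deg : ∀ {n} {G : SimpleGraph n} → Fin n → List (Edge G) → ℕ
deg v [] = 0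
deg v (e ∷ H) with v ≟ src e | v ≟ tgt e
... | yes _ | _     = suc (deg v H)
... | no _  | yes _ = suc (deg v H)
... | no _  | no _  = deg v H

-- H (a list of pairwise distinct edges) is a face of BD^λ(G).
IsFace : ∀ {n} (G : SimpleGraph n) (λ⃗ : Fin n → ℕ) → List (Edge G) → Set
IsFace G λ⃗ H = ∀ v → deg v H ≤ λ⃗ v

BDEdge : ∀ {n} (G : SimpleGraph n) (λ⃗ : Fin n → ℕ) → Edge G → Edge G → Set
BDEdge G λ⃗ e f = ¬ (e ≈E f) × IsFace G λ⃗ (e ∷ f ∷ [])

Connected : ∀ {n} (G : SimpleGraph n) (λ⃗ : Fin n → ℕ) → Edge G → Edge G → Set
Connected G λ⃗ = Star (BDEdge G λ⃗)

TwoNontrivialComponents : ∀ {n} (G : SimpleGraph n) (λ⃗ : Fin n → ℕ) → Set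
TwoNontrivialComponents G λ⃗ =
  ∃[ e₁ ] ∃[ e₂ ] ∃[ f₁ ] ∃[ f₂ ]
    (¬ (e₁ ≈E e₂) × Connected G λ⃗ e₁ e₂ ×
     ¬ (f₁ ≈E f₂) × Connected G λ⃗ f₁ f₂ ×
     ¬ Connected G λ⃗ e₁ f₁)

HasC4 : ∀ {n} → SimpleGraph n → Set
HasC4 {n} G = ∃[ a ] ∃[ b ] ∃[ c ] ∃[ d ]
  (a ≢ b × a ≢ c × a ≢ d × b ≢ c × b ≢ d × c ≢ d ×
   Adj G a b × Adj G b c × Adj G c d × Adj G d a)

-- Call a vertex tight when its label is at most 1. Two distinct edges e, f of G
-- span an edge of BD^λ(G) exactly when all their endpoints have positive label
-- and they share no tight vertex. Hence if e₁ — e₂ and f₁ — f₂ are edges of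
-- BD^λ(G) in different components, then e₁ ∩ e₂ and f₁ ∩ f₂ contain no tight
-- vertex, while every eᵢ meets every fⱼ in a tight vertex. Taking a ∈ e₁ ∩ f₁,
-- b ∈ e₁ ∩ f₂, c ∈ e₂ ∩ f₁, x ∈ e₂ ∩ f₂, these four vertices are pairwise
-- distinct (a, b, c are tight, and any two of the four lie on opposite sides of
-- e₁, e₂ or of f₁, f₂), so a b x c is a 4-cycle.
module Submission where

open import Defs
open import Data.Nat using (ℕ; suc; _≤_; z≤n; s≤s; _≤?_)
open import Data.Nat.Properties using (≤-refl; ≤-reflexive; ≤-trans; n≤1+n; ≰⇒>)
open import Data.Fin using (Fin; _≟_)
open import Data.Fin.Properties using (any?)
open import Data.List using (List; []; _∷_)
open import Data.Product using (_×_; ∃-syntax; _,_; proj₁; proj₂)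
open import Data.Empty using (⊥-elim)
open import Function using (_∘_; case_of_)
open import Function.Bundles using (_⇔_; mk⇔; Equivalence)
open import Relation.Nullary using (¬_; Dec; yes; no)
open import Relation.Nullary.Decidable using (_×-dec_)
open import Relation.Binary.PropositionalEquality using (_≡_; _≢_; refl; trans; cong; subst; ≢-sym)
import Relation.Binary.PropositionalEquality as ≡
open import Relation.Binary.Construct.Closure.ReflexiveTransitive using (ε; _◅_; _◅◅_; reverse)

module _ {n : ℕ} {G : SimpleGraph n} where

  infix 4 _∈ₑ_ _∉ₑ_

  data _∈ₑ_ (v : Fin n) (e : Edge G) : Set where
    src∈ : v ≡ src e → v ∈ₑ e
    tgt∈ : v ≡ tgt e → v ∈ₑ e

  _∉ₑ_ : Fin n → Edge G → Set
  v ∉ₑ e = ¬ v ∈ₑ e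

  _∈ₑ?_ : ∀ v e → Dec (v ∈ₑ e)
  v ∈ₑ? e with v ≟ src e | v ≟ tgt e
  ... | yes s | _     = yes (src∈ s)
  ... | no _  | yes t = yes (tgt∈ t)
  ... | no ¬s | no ¬t = no λ { (src∈ s) → ¬s s ; (tgt∈ t) → ¬t t }

  ≈E-sym : ∀ {e f : Edge G} → e ≈E f → f ≈E e
  ≈E-sym (s , t) = ≡.sym s , ≡.sym t

  ≈E-trans : ∀ {e f g : Edge G} → e ≈E f → f ≈E g → e ≈E g
  ≈E-trans (s , t) (s′ , t′) = trans s s′ , trans t t′

  ∈ₑ-resp-≈E : ∀ {v} {e f : Edge G} → e ≈E f → v ∈ₑ e → v ∈ₑ f
  ∈ₑ-resp-≈E (s , _) (src∈ p) = src∈ (trans p s)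
  ∈ₑ-resp-≈E (_ , t) (tgt∈ p) = tgt∈ (trans p t)

  adj-∈ₑ : ∀ {u v} {e : Edge G} → u ∈ₑ e → v ∈ₑ e → u ≢ v → Adj G u v
  adj-∈ₑ (src∈ refl) (src∈ refl) u≢v = ⊥-elim (u≢v refl)
  adj-∈ₑ {e = e} (src∈ refl) (tgt∈ refl) _ = adj e
  adj-∈ₑ {e = e} (tgt∈ refl) (src∈ refl) _ = SimpleGraph.sym G (adj e)
  adj-∈ₑ (tgt∈ refl) (tgt∈ refl) u≢v = ⊥-elim (u≢v refl)

  Meet : (Fin n → Set) → Edge G → Edge G → Set
  Meet T e f = ∃[ v ] v ∈ₑ e × v ∈ₑ f × T v

  meet? : ∀ {T : Fin n → Set} → (∀ v → Dec (T v)) → ∀ e f → Dec (Meet T e f)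
  meet? T? e f = any? (λ v → (v ∈ₑ? e) ×-dec (v ∈ₑ? f) ×-dec T? v)

  Meet-sym : ∀ {T : Fin n → Set} {e f : Edge G} → Meet T e f → Meet T f e
  Meet-sym (v , v∈e , v∈f , Tv) = v , v∈f , v∈e , Tv

  Meet-respˡ-≈E : ∀ {T : Fin n → Set} {e e′ f : Edge G} → e ≈E e′ → Meet T e f → Meet T e′ f
  Meet-respˡ-≈E e≈e′ (v , v∈e , v∈f , Tv) = v , ∈ₑ-resp-≈E e≈e′ v∈e , v∈f , Tv

  apart : ∀ {T : Fin n → Set} {e f : Edge G} {u v} →
    ¬ Meet T e f → u ∈ₑ e → v ∈ₑ f → T u → u ≢ v
  apart e∦f u∈e v∈f Tu refl = e∦f (_ , u∈e , v∈f , Tu)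

  meetingPattern⇒C4 : ∀ {T : Fin n → Set} {e₁ e₂ f₁ f₂ : Edge G} →
    ¬ Meet T e₁ e₂ → ¬ Meet T f₁ f₂ →
    Meet T e₁ f₁ → Meet T e₁ f₂ → Meet T e₂ f₁ → Meet T e₂ f₂ → HasC4 G
  meetingPattern⇒C4 e₁∦e₂ f₁∦f₂
    (a , a∈e₁ , a∈f₁ , Ta) (b , b∈e₁ , b∈f₂ , Tb) (c , c∈e₂ , c∈f₁ , Tc) (x , x∈e₂ , x∈f₂ , _) =
    a , b , x , c , a≢b , a≢x , a≢c , b≢x , b≢c , x≢c ,
    adj-∈ₑ a∈e₁ b∈e₁ a≢b , adj-∈ₑ b∈f₂ x∈f₂ b≢x ,
    adj-∈ₑ x∈e₂ c∈e₂ x≢c , adj-∈ₑ c∈f₁ a∈f₁ (≢-sym a≢c)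
    where
    a≢b : a ≢ b
    a≢b = apart f₁∦f₂ a∈f₁ b∈f₂ Ta
    a≢x : a ≢ x
    a≢x = apart e₁∦e₂ a∈e₁ x∈e₂ Ta
    a≢c : a ≢ c
    a≢c = apart e₁∦e₂ a∈e₁ c∈e₂ Ta
    b≢x : b ≢ x
    b≢x = apart e₁∦e₂ b∈e₁ x∈e₂ Tb
    b≢c : b ≢ c
    b≢c = apart e₁∦e₂ b∈e₁ c∈e₂ Tb
    x≢c : x ≢ c
    x≢c = ≢-sym (apart f₁∦f₂ c∈f₁ x∈f₂ Tc)

  module _ {v : Fin n} {e : Edge G} {H : List (Edge G)} where

    deg-∷-∈ : v ∈ₑ e → deg v (e ∷ H) ≡ suc (deg v H)
    deg-∷-∈ v∈e with v ≟ src e | v ≟ tgt e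
    ... | yes _ | _     = refl
    ... | no _  | yes _ = refl
    ... | no ¬s | no ¬t = ⊥-elim (case v∈e of λ { (src∈ s) → ¬s s ; (tgt∈ t) → ¬t t })

    deg-∷-∉ : v ∉ₑ e → deg v (e ∷ H) ≡ deg v H
    deg-∷-∉ v∉e with v ≟ src e | v ≟ tgt e
    ... | yes s | _     = ⊥-elim (v∉e (src∈ s))
    ... | no _  | yes t = ⊥-elim (v∉e (tgt∈ t))
    ... | no _  | no _  = refl

    deg-≤-∷ : deg v H ≤ deg v (e ∷ H)
    deg-≤-∷ with v ≟ src e | v ≟ tgt e
    ... | yes _ | _     = n≤1+n _
    ... | no _  | yes _ = n≤1+n _
    ... | no _  | no _  = ≤-refl

module _ {n : ℕ} {G : SimpleGraph n} (λ⃗ : Fin n → ℕ) where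

  Tight : Fin n → Set
  Tight v = λ⃗ v ≤ 1

  tight? : ∀ v → Dec (Tight v)
  tight? v = λ⃗ v ≤? 1

  Positive : Edge G → Set
  Positive e = ∀ v → v ∈ₑ e → 1 ≤ λ⃗ v

  isFace-pair⇔ : ∀ {e f : Edge G} →
    IsFace G λ⃗ (e ∷ f ∷ []) ⇔ (Positive e × Positive f × ¬ Meet Tight e f)
  isFace-pair⇔ {e} {f} = mk⇔ (λ face → positiveˡ face , positiveʳ face , noTightMeet face) pairFace
    where
    positiveˡ : IsFace G λ⃗ (e ∷ f ∷ []) → Positive e
    positiveˡ face v v∈e = ≤-trans (s≤s z≤n) (subst (_≤ λ⃗ v) (deg-∷-∈ v∈e) (face v))

    positiveʳ : IsFace G λ⃗ (e ∷ f ∷ []) → Positive f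
    positiveʳ face v v∈f =
      ≤-trans (subst (1 ≤_) (≡.sym (deg-∷-∈ {H = []} v∈f)) (s≤s z≤n))
              (≤-trans (deg-≤-∷ {v = v} {e = e} {H = f ∷ []}) (face v))

    noTightMeet : IsFace G λ⃗ (e ∷ f ∷ []) → ¬ Meet Tight e f
    noTightMeet face (v , v∈e , v∈f , tight) = 2≰1 (subst (_≤ 1) deg≡2 (≤-trans (face v) tight))
      where
      deg≡2 : deg v (e ∷ f ∷ []) ≡ 2
      deg≡2 = trans (deg-∷-∈ v∈e) (cong suc (deg-∷-∈ v∈f))

      2≰1 : ¬ 2 ≤ 1
      2≰1 (s≤s ())

    pairFace : Positive e × Positive f × ¬ Meet Tight e f → IsFace G λ⃗ (e ∷ f ∷ [])
    pairFace (pe , pf , e∦f) v with v ∈ₑ? e | v ∈ₑ? f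
    ... | yes p | yes q = ≤-trans (≤-reflexive (trans (deg-∷-∈ p) (cong suc (deg-∷-∈ q))))
                                  (≰⇒> (λ tight → e∦f (v , p , q , tight)))
    ... | yes p | no q  = ≤-trans (≤-reflexive (trans (deg-∷-∈ p) (cong suc (deg-∷-∉ q)))) (pe v p)
    ... | no p  | yes q = ≤-trans (≤-reflexive (trans (deg-∷-∉ p) (deg-∷-∈ q))) (pf v q)
    ... | no p  | no q  = ≤-trans (≤-reflexive (trans (deg-∷-∉ p) (deg-∷-∉ q))) z≤n

  BDEdge⇔ : ∀ {e f : Edge G} →
    BDEdge G λ⃗ e f ⇔ (¬ e ≈E f × Positive e × Positive f × ¬ Meet Tight e f)
  BDEdge⇔ = mk⇔ (λ (e≉f , face) → e≉f , Equivalence.to isFace-pair⇔ face)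
                (λ (e≉f , facts) → e≉f , Equivalence.from isFace-pair⇔ facts)

  BDEdge-sym : ∀ {e f : Edge G} → BDEdge G λ⃗ e f → BDEdge G λ⃗ f e
  BDEdge-sym {e} {f} e—f with Equivalence.to (BDEdge⇔ {e} {f}) e—f
  ... | e≉f , pe , pf , e∦f =
    Equivalence.from BDEdge⇔ (e≉f ∘ ≈E-sym {e = f} {f = e} , pf , pe , e∦f ∘ Meet-sym)

  BDEdge-respˡ-≈E : ∀ {e e′ f : Edge G} → e ≈E e′ → BDEdge G λ⃗ e f → BDEdge G λ⃗ e′ f
  BDEdge-respˡ-≈E {e} {e′} {f} e≈e′ e—f with Equivalence.to (BDEdge⇔ {e} {f}) e—f
  ... | e≉f , pe , pf , e∦f = Equivalence.from BDEdge⇔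
    ( (λ e′≈f → e≉f (≈E-trans {e = e} {f = e′} {g = f} e≈e′ e′≈f))
    , (λ v v∈e′ → pe v (∈ₑ-resp-≈E e′≈e v∈e′))
    , pf
    , e∦f ∘ Meet-respˡ-≈E e′≈e )
    where
    e′≈e : e′ ≈E e
    e′≈e = ≈E-sym {e = e} {f = e′} e≈e′

  module _ {e f : Edge G} (e—f : BDEdge G λ⃗ e f) where

    BDEdge⇒positive : Positive e
    BDEdge⇒positive = proj₁ (proj₂ (Equivalence.to (BDEdge⇔ {e} {f}) e—f))

    BDEdge⇒¬Meet : ¬ Meet Tight e f
    BDEdge⇒¬Meet = proj₂ (proj₂ (proj₂ (Equivalence.to (BDEdge⇔ {e} {f}) e—f)))

  separated⇒Meet : ∀ {e f X X′ Y Y′ : Edge G} → ¬ Connected G λ⃗ e f →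
    Connected G λ⃗ e X → Connected G λ⃗ f Y → BDEdge G λ⃗ X X′ → BDEdge G λ⃗ Y Y′ →
    Meet Tight X Y
  separated⇒Meet {X = X} {Y = Y} e≁f e~X f~Y X—X′ Y—Y′
    with meet? tight? X Y
  ... | yes X∩Y = X∩Y
  ... | no X∦Y = ⊥-elim (e≁f (e~X ◅◅ X—Y ◅ reverse BDEdge-sym f~Y))
    where
    X≉Y : ¬ X ≈E Y
    X≉Y X≈Y = e≁f (e~X ◅◅ X—X′ ◅ BDEdge-sym (BDEdge-respˡ-≈E X≈Y X—X′) ◅ reverse BDEdge-sym f~Y)

    X—Y : BDEdge G λ⃗ X Y
    X—Y = Equivalence.from BDEdge⇔
      (X≉Y , BDEdge⇒positive X—X′ , BDEdge⇒positive Y—Y′ , X∦Y)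

lemma3p2 : ∀ {n} (G : SimpleGraph n) (λ⃗ : Fin n → ℕ) →
    TwoNontrivialComponents G λ⃗ → HasC4 G
lemma3p2 G λ⃗ (e₁ , e₂ , f₁ , f₂ , e₁≉e₂ , ε , _) = ⊥-elim (e₁≉e₂ (refl , refl))
lemma3p2 G λ⃗ (e₁ , e₂ , f₁ , f₂ , _ , _ , f₁≉f₂ , ε , _) = ⊥-elim (f₁≉f₂ (refl , refl))
lemma3p2 G λ⃗ (e₁ , e₂ , f₁ , f₂ , _ , e₁—e′ ◅ _ , _ , f₁—f′ ◅ _ , e₁≁f₁) =
  meetingPattern⇒C4 (BDEdge⇒¬Meet λ⃗ e₁—e′) (BDEdge⇒¬Meet λ⃗ f₁—f′)
    (separated⇒Meet λ⃗ e₁≁f₁ ε ε e₁—e′ f₁—f′)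
    (separated⇒Meet λ⃗ e₁≁f₁ ε (f₁—f′ ◅ ε) e₁—e′ (BDEdge-sym λ⃗ f₁—f′))
    (separated⇒Meet λ⃗ e₁≁f₁ (e₁—e′ ◅ ε) ε (BDEdge-sym λ⃗ e₁—e′) f₁—f′)
    (separated⇒Meet λ⃗ e₁≁f₁ (e₁—e′ ◅ ε) (f₁—f′ ◅ ε) (BDEdge-sym λ⃗ e₁—e′) (BDEdge-sym λ⃗ f₁—f′))
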